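{- Let $F\subseteq E$ and let $(p,f)$ be an $F$-allocation such that $\phi(p,f)<\Psi(F)/(n(m+1))$. Then $f_{ij}>\|s(p,f)\|_1$ for at least one edge $(i,g_j)\in E\setminus F$ such that $i$ and $g_j$ lie in two different connected components of the undirected bipartite graph $(A\cup G, F)$.
   Context: Linear exchange market: agents $A=[n]$, goods $G=\{g_1,\dots,g_n\}$, one unit of each good, agent $i$ owns the unit of $g_i$; utilities $u_{ij}\ge0$; $E=\{(i,g_j): u_{ij}>0\}$, $m=|E|$. For prices $p>0$, $\mathrm{MBB}(p)$ is the set of $(i,g_j)\in E$ with $u_{ij}/p_j=\max_k u_{ik}/p_k$. For $F\subseteq E$, $(p,f)$ is an $F$-allocation if (i) $p>0$ and $f_{ij}\ge 0$ for $(i,g_j)\notin F$; (ii) $\mathrm{supp}(f)\cup F\subseteq \mathrm{MBB}(p)$; (iii) $\sum_j f_{ij}\le p_i$ for all $i\in A$; (iv) $\sum_i f_{ij}\le p_j$ for all $g_j$. Surplus of good $g_j$: $s_j(p,f)=p_j-\sum_i f_{ij}$. $\phi(p,f)=\|s(p,f)\|_\infty/(\prod_{j=1}^n p_j)^{1/n}$, and $\Psi(F)=\min\{\phi(p,f): (p,f)\text{ an }F\text{ -allocation with }\mathrm{supp}(f)\subseteq F\}$. -}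

module Defs where

open import Level using (0ℓ)
open import Algebra.Bundles using (CommutativeRing)
open import Relation.Binary.Structures using (IsStrictTotalOrder)
open import Relation.Binary.Definitions using (tri<; tri≈; tri>)
open import Relation.Binary.Construct.Closure.ReflexiveTransitive using (Star)
open import Relation.Nullary using (¬_)
open import Data.Nat using (ℕ; zero; suc)
import Data.Nat as ℕ
open import Data.Fin using (Fin)
import Data.Fin as Fin
open import Data.Sum using (_⊎_; inj₁; inj₂)
open import Data.Product using (Σ; ∃; _×_; _,_)

-- The real numbers, axiomatised as a complete ordered field.
-- (agda-stdlib has no reals; every model of this record is ℝ.)

record CompleteOrderedField : Set₁ where
  field
    commutativeRing : CommutativeRing 0ℓ 0ℓ
  open CommutativeRing commutativeRing public
  infix 4 _<_
  infix 8 _⁻¹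
  field
    _<_                : Carrier → Carrier → Set
    isStrictTotalOrder : IsStrictTotalOrder _≈_ _<_
    nontrivial         : ¬ (1# ≈ 0#)
    +-monoˡ-<          : ∀ {x y} z → x < y → x + z < y + z
    *-pos              : ∀ {x y} → 0# < x → 0# < y → 0# < x * y
    -- multiplicative inverse (total function; specified only on x ≉ 0)
    _⁻¹                : Carrier → Carrier
    ⁻¹-inverse         : ∀ x → ¬ (x ≈ 0#) → x * x ⁻¹ ≈ 1#
    sup : (P : Carrier → Set) → ∃ P →
          ∃ (λ b → ∀ x → P x → (x < b ⊎ x ≈ b)) →
          ∃ (λ s → (∀ x → P x → (x < s ⊎ x ≈ s)) ×
                   (∀ b → (∀ x → P x → (x < b ⊎ x ≈ b)) → (s < b ⊎ s ≈ b)))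

  open IsStrictTotalOrder isStrictTotalOrder public
    using (compare)

  infix 4 _≤_
  _≤_ : Carrier → Carrier → Set
  x ≤ y = x < y ⊎ x ≈ y

  infixl 7 _/_
  _/_ : Carrier → Carrier → Carrier
  x / y = x * y ⁻¹

  infixl 6 _−_
  _−_ : Carrier → Carrier → Carrier
  x − y = x + (- y)

  fromℕ : ℕ → Carrier
  fromℕ zero    = 0#
  fromℕ (suc k) = 1# + fromℕ k

  infixr 8 _^_
  _^_ : Carrier → ℕ → Carrier
  x ^ zero  = 1#
  x ^ suc k = x * (x ^ k)

  max : Carrier → Carrier → Carrier
  max x y with compare x y
  ... | tri< _ _ _ = y
  ... | tri≈ _ _ _ = x
  ... | tri> _ _ _ = x

  ∣_∣ : Carrier → Carrier
  ∣ x ∣ with compare x 0#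
  ... | tri< _ _ _ = - x
  ... | tri≈ _ _ _ = x
  ... | tri> _ _ _ = x

  Σ[_] : ∀ {n} → (Fin n → Carrier) → Carrier
  Σ[_] {zero}  v = 0#
  Σ[_] {suc n} v = v Fin.zero + Σ[ (λ i → v (Fin.suc i)) ]

  Π[_] : ∀ {n} → (Fin n → Carrier) → Carrier
  Π[_] {zero}  v = 1#
  Π[_] {suc n} v = v Fin.zero * Π[ (λ i → v (Fin.suc i)) ]

  -- max(0, v_1, ..., v_n); used only on nonnegative entries
  Max[_] : ∀ {n} → (Fin n → Carrier) → Carrier
  Max[_] {zero}  v = 0#
  Max[_] {suc n} v = max (v Fin.zero) Max[ (λ i → v (Fin.suc i)) ]

  ‖_‖∞ : ∀ {n} → (Fin n → Carrier) → Carrier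
  ‖ v ‖∞ = Max[ (λ j → ∣ v j ∣) ]

  ‖_‖₁ : ∀ {n} → (Fin n → Carrier) → Carrier
  ‖ v ‖₁ = Σ[ (λ j → ∣ v j ∣) ]

sumℕ : ∀ {n} → (Fin n → ℕ) → ℕ
sumℕ {zero}  v = 0
sumℕ {suc n} v = v Fin.zero ℕ.+ sumℕ (λ i → v (Fin.suc i))

-- Linear exchange market with n agents (Fin n) and n goods (Fin n);
-- agent i owns good g_i.  Utilities u i j = u_{ij}.

module Market (R : CompleteOrderedField) {n : ℕ} (u : Fin n → Fin n → CompleteOrderedField.Carrier R) where
  open CompleteOrderedField R

  Prices : Set
  Prices = Fin n → Carrier

  Flow : Set
  Flow = Fin n → Fin n → Carrier

  EdgeSet : Set₁
  EdgeSet = Fin n → Fin n → Set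

  E : EdgeSet
  E i j = 0# < u i j

  _⊆_ : EdgeSet → EdgeSet → Set
  F ⊆ F' = ∀ i j → F i j → F' i j

  m : ℕ
  m = sumℕ (λ i → sumℕ (λ j → ind (u i j)))
    where
    ind : Carrier → ℕ
    ind x with compare 0# x
    ... | tri< _ _ _ = 1
    ... | tri≈ _ _ _ = 0
    ... | tri> _ _ _ = 0

  MBB : Prices → EdgeSet
  MBB p i j = E i j × (∀ k → u i k / p k ≤ u i j / p j)

  supp : Flow → EdgeSet
  supp f i j = ¬ (f i j ≈ 0#)

  surplus : Prices → Flow → Fin n → Carrier
  surplus p f j = p j − Σ[ (λ i → f i j) ]

  record IsAllocation (F : EdgeSet) (p : Prices) (f : Flow) : Set where
    field
      prices-pos   : ∀ j → 0# < p j
      flow-nonneg  : ∀ i j → ¬ F i j → 0# ≤ f i j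
      supp⊆MBB     : supp f ⊆ MBB p
      F⊆MBB        : F ⊆ MBB p
      agent-budget : ∀ i → Σ[ (λ j → f i j) ] ≤ p i
      good-cap     : ∀ j → Σ[ (λ i → f i j) ] ≤ p j

  -- g is the geometric mean (Π_j p_j)^{1/n} of the prices:
  -- the (unique) positive g with g^n = Π_j p_j
  IsGeoMean : Prices → Carrier → Set
  IsGeoMean p g = 0# < g × g ^ n ≈ Π[ p ]

  -- φ(p,f) = ‖s(p,f)‖∞ / (Π_j p_j)^{1/n}, with g the geometric mean
  φ : Prices → Flow → (g : Carrier) → Carrier
  φ p f g = ‖ surplus p f ‖∞ / g

  -- c is a lower bound of {φ(q,h) : (q,h) F-allocation, supp(h) ⊆ F};
  -- Ψ(F) is the greatest such (the minimum of that set).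
  IsLowerBoundΨ : EdgeSet → Carrier → Set
  IsLowerBoundΨ F c = ∀ q h → IsAllocation F q h → supp h ⊆ F →
                      ∀ g → IsGeoMean q g → c ≤ φ q h g

  -- undirected bipartite graph (A ∪ G, F): vertices inj₁ i (agents),
  -- inj₂ j (goods); connected components via reflexive-transitive closure
  Vertex : Set
  Vertex = Fin n ⊎ Fin n

  data Adj (F : EdgeSet) : Vertex → Vertex → Set where
    ag : ∀ {i j} → F i j → Adj F (inj₁ i) (inj₂ j)
    ga : ∀ {i j} → F i j → Adj F (inj₂ j) (inj₁ i)

  SameComponent : EdgeSet → Vertex → Vertex → Set
  SameComponent F = Star (Adj F)

-- If every edge of E joining two components of (A ∪ G, F) carried at most ‖s‖₁, the flow could be
-- moved onto F: the flow of an edge (k, g_l) inside a component is pushed along an F-path from k to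
-- g_l with alternating signs, which changes only the totals at k and g_l, and the flow of every other
-- edge is dropped. This yields an F-allocation (p, h) with supp h ⊆ F whose surplus at each good
-- exceeds that of (p, f) by at most m ‖s‖₁ ≤ n m ‖s‖∞, so Ψ(F) ≤ φ(p, h) ≤ n (m+1) φ(p, f).
-- Completeness of the field provides the geometric mean and decides non-connectivity, so the heavy
-- edge is then found by a finite search.

module Submission where

open import Defs
open import Level using (0ℓ)
open import Data.Nat using (ℕ; zero; suc)
import Data.Nat as ℕ
import Data.Nat.Properties as ℕ
open import Data.Fin using (Fin)
import Data.Fin as Fin
open import Data.Sum using (_⊎_; inj₁; inj₂)
open import Data.Product using (Σ; ∃; _×_; _,_; proj₁; proj₂)
open import Data.Empty using (⊥-elim)
open import Relation.Nullary using (¬_; Dec; yes; no)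
open import Relation.Nullary.Decidable using (decidable-stable; _×-dec_; ¬¬-excluded-middle)
open import Relation.Nullary.Negation using (¬¬-Monad)
open import Effect.Monad using (RawMonad)
open import Data.Fin.Properties using (any?; sequence)
open import Relation.Binary.Bundles using (StrictPartialOrder)
open import Relation.Binary.Definitions using (tri<; tri≈; tri>)
open import Relation.Binary.Structures using (IsStrictTotalOrder)
open import Relation.Binary.PropositionalEquality as ≡ using (_≡_)
open import Relation.Binary.Construct.Closure.ReflexiveTransitive using (Star; _◅_)
import Relation.Binary.Construct.StrictToNonStrict as NonStrict
import Relation.Binary.Reasoning.Setoid as SetoidReasoning
import Relation.Binary.Reasoning.StrictPartialOrder as StrictPartialOrderReasoning

sumℕ-mono-≤ : ∀ {k} {v w : Fin k → ℕ} → (∀ i → v i ℕ.≤ w i) → sumℕ v ℕ.≤ sumℕ w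
sumℕ-mono-≤ {zero}  v≤w = ℕ.z≤n
sumℕ-mono-≤ {suc k} v≤w = ℕ.+-mono-≤ (v≤w Fin.zero) (sumℕ-mono-≤ (λ i → v≤w (Fin.suc i)))

v≤sumℕv : ∀ {k} (v : Fin k → ℕ) i → v i ℕ.≤ sumℕ v
v≤sumℕv v Fin.zero    = ℕ.m≤m+n _ _
v≤sumℕv v (Fin.suc i) = ℕ.≤-trans (v≤sumℕv (λ j → v (Fin.suc j)) i) (ℕ.m≤n+m _ _)

module OrderedFieldProperties (R : CompleteOrderedField) where
  open CompleteOrderedField R
  open IsStrictTotalOrder isStrictTotalOrder public
    using (irrefl; asym; <-respʳ-≈; <-respˡ-≈; <-resp-≈; _<?_; _≟_)
    renaming (trans to <-trans)
  open import Algebra.Properties.Ring ring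
    using (-‿involutive; -1*x≈-x; -0#≈0#; x[y-z]≈xy-xz; [y-z]x≈yx-zx)
  open import Algebra.Properties.AbelianGroup +-abelianGroup
    using (⁻¹-∙-comm; ⁻¹-anti-homo‿-)
  open import Algebra.Properties.Group +-group
    using (//-rightDividesˡ; \\-leftDividesʳ)
  open import Algebra.Properties.CommutativeSemigroup +-commutativeSemigroup
    using (interchange; x∙yz≈y∙xz)
  open import Algebra.Properties.CommutativeSemigroup *-commutativeSemigroup
    using () renaming (x∙yz≈y∙xz to x*yz≈y*xz)

  strictPartialOrder : StrictPartialOrder 0ℓ 0ℓ 0ℓ
  strictPartialOrder = record
    { isStrictPartialOrder = IsStrictTotalOrder.isStrictPartialOrder isStrictTotalOrder }

  module ≈-Reasoning = SetoidReasoning setoid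
  module ≤-Reasoning = StrictPartialOrderReasoning strictPartialOrder

  ≤-refl : ∀ {x} → x ≤ x
  ≤-refl = inj₂ refl

  ≤-trans : ∀ {x y z} → x ≤ y → y ≤ z → x ≤ z
  ≤-trans = NonStrict.trans _≈_ _<_ isEquivalence <-resp-≈ <-trans

  <-≤-trans : ∀ {x y z} → x < y → y ≤ z → x < z
  <-≤-trans = NonStrict.<-≤-trans _≈_ _<_ <-trans <-respʳ-≈

  ≤-<-trans : ∀ {x y z} → x ≤ y → y < z → x < z
  ≤-<-trans = NonStrict.≤-<-trans _≈_ _<_ sym <-trans <-respˡ-≈

  ≤-respʳ-≈ : ∀ {x y z} → y ≈ z → x ≤ y → x ≤ z
  ≤-respʳ-≈ = NonStrict.≤-respʳ-≈ _≈_ _<_ trans <-respʳ-≈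

  ≤-respˡ-≈ : ∀ {x y z} → y ≈ z → y ≤ x → z ≤ x
  ≤-respˡ-≈ = NonStrict.≤-respˡ-≈ _≈_ _<_ sym trans <-respˡ-≈

  <-≈-cong : ∀ {x x′ y y′} → x ≈ x′ → y ≈ y′ → x < y → x′ < y′
  <-≈-cong x≈x′ y≈y′ x<y = <-respˡ-≈ x≈x′ (<-respʳ-≈ y≈y′ x<y)

  <-irrefl : ∀ {x} → ¬ (x < x)
  <-irrefl = irrefl refl

  ≤⇒≯ : ∀ {x y} → x ≤ y → ¬ (y < x)
  ≤⇒≯ x≤y y<x = <-irrefl (≤-<-trans x≤y y<x)

  ≮⇒≥ : ∀ {x y} → ¬ (x < y) → y ≤ x
  ≮⇒≥ {x} {y} x≮y with compare x y
  ... | tri< x<y _ _ = ⊥-elim (x≮y x<y)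
  ... | tri≈ _ x≈y _ = inj₂ (sym x≈y)
  ... | tri> _ _ y<x = inj₁ y<x

  [x−y]+[y−z]≈x−z : ∀ x y z → (x − y) + (y − z) ≈ x − z
  [x−y]+[y−z]≈x−z x y z = trans (+-assoc x (- y) (y − z)) (+-congˡ (\\-leftDividesʳ y (- z)))

  +-monoʳ-< : ∀ {x y} z → x < y → z + x < z + y
  +-monoʳ-< {x} {y} z x<y = <-≈-cong (+-comm x z) (+-comm y z) (+-monoˡ-< z x<y)

  +-monoˡ-≤ : ∀ {x y} z → x ≤ y → x + z ≤ y + z
  +-monoˡ-≤ z (inj₁ x<y) = inj₁ (+-monoˡ-< z x<y)
  +-monoˡ-≤ z (inj₂ x≈y) = inj₂ (+-congʳ x≈y)

  +-monoʳ-≤ : ∀ {x y} z → x ≤ y → z + x ≤ z + y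
  +-monoʳ-≤ z (inj₁ x<y) = inj₁ (+-monoʳ-< z x<y)
  +-monoʳ-≤ z (inj₂ x≈y) = inj₂ (+-congˡ x≈y)

  +-mono-≤ : ∀ {a b c d} → a ≤ b → c ≤ d → a + c ≤ b + d
  +-mono-≤ {b = b} {c} a≤b c≤d = ≤-trans (+-monoˡ-≤ c a≤b) (+-monoʳ-≤ b c≤d)

  x≤x+y : ∀ {x y} → 0# ≤ y → x ≤ x + y
  x≤x+y {x} 0≤y = ≤-respˡ-≈ (+-identityʳ x) (+-monoʳ-≤ x 0≤y)

  x<x+y : ∀ {x y} → 0# < y → x < x + y
  x<x+y {x} 0<y = <-respˡ-≈ (+-identityʳ x) (+-monoʳ-< x 0<y)

  <⇒0<− : ∀ {x y} → x < y → 0# < y − x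
  <⇒0<− {x} x<y = <-respˡ-≈ (-‿inverseʳ x) (+-monoˡ-< (- x) x<y)

  0<−⇒< : ∀ {x y} → 0# < y − x → x < y
  0<−⇒< {x} {y} 0<y−x =
    <-≈-cong (+-identityˡ x) (//-rightDividesˡ x y) (+-monoˡ-< x 0<y−x)

  ≤⇒0≤− : ∀ {x y} → x ≤ y → 0# ≤ y − x
  ≤⇒0≤− (inj₁ x<y) = inj₁ (<⇒0<− x<y)
  ≤⇒0≤− {x} (inj₂ x≈y) = inj₂ (sym (trans (+-congʳ (sym x≈y)) (-‿inverseʳ x)))

  -‿anti-< : ∀ {x y} → x < y → - y < - x
  -‿anti-< {x} {y} x<y = 0<−⇒< (<-respʳ-≈ y−x≈-x−-y (<⇒0<− x<y))
    where
    y−x≈-x−-y : y − x ≈ - x − - y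
    y−x≈-x−-y = trans (+-comm y (- x)) (+-congˡ (sym (-‿involutive y)))

  x<0⇒0<-x : ∀ {x} → x < 0# → 0# < - x
  x<0⇒0<-x x<0 = <-respˡ-≈ -0#≈0# (-‿anti-< x<0)

  0<1 : 0# < 1#
  0<1 with compare 0# 1#
  ... | tri< 0<1 _ _ = 0<1
  ... | tri≈ _ 0≈1 _ = ⊥-elim (nontrivial (sym 0≈1))
  ... | tri> _ _ 1<0 = ⊥-elim (asym 1<0 (<-respʳ-≈ -1*-1≈1 (*-pos 0<-1 0<-1)))
    where
    0<-1 : 0# < - 1#
    0<-1 = x<0⇒0<-x 1<0
    -1*-1≈1 : - 1# * - 1# ≈ 1#
    -1*-1≈1 = trans (-1*x≈-x (- 1#)) (-‿involutive 1#)

  *-monoˡ-< : ∀ {x y z} → 0# < z → x < y → z * x < z * y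
  *-monoˡ-< {x} {y} {z} 0<z x<y =
    0<−⇒< (<-respʳ-≈ (x[y-z]≈xy-xz z y x) (*-pos 0<z (<⇒0<− x<y)))

  *-monoʳ-< : ∀ {x y z} → 0# < z → x < y → x * z < y * z
  *-monoʳ-< {x} {y} {z} 0<z x<y = <-≈-cong (*-comm z x) (*-comm z y) (*-monoˡ-< 0<z x<y)

  *-monoˡ-≤ : ∀ {x y z} → 0# ≤ z → x ≤ y → z * x ≤ z * y
  *-monoˡ-≤ (inj₁ 0<z) (inj₁ x<y) = inj₁ (*-monoˡ-< 0<z x<y)
  *-monoˡ-≤ (inj₁ 0<z) (inj₂ x≈y) = inj₂ (*-congˡ x≈y)
  *-monoˡ-≤ {x} {y} {z} (inj₂ 0≈z) _ = inj₂ (trans (z*w≈0 x) (sym (z*w≈0 y)))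
    where
    z*w≈0 : ∀ w → z * w ≈ 0#
    z*w≈0 w = trans (*-congʳ (sym 0≈z)) (zeroˡ w)

  *-monoʳ-≤ : ∀ {x y z} → 0# ≤ z → x ≤ y → x * z ≤ y * z
  *-monoʳ-≤ {x} {y} {z} 0≤z x≤y = ≤-respʳ-≈ (*-comm z y) (≤-respˡ-≈ (*-comm z x) (*-monoˡ-≤ 0≤z x≤y))

  *-mono-≤ : ∀ {a b c d} → 0# ≤ a → 0# ≤ c → a ≤ b → c ≤ d → a * c ≤ b * d
  *-mono-≤ 0≤a 0≤c a≤b c≤d = ≤-trans (*-monoʳ-≤ 0≤c a≤b) (*-monoˡ-≤ (≤-trans 0≤a a≤b) c≤d)

  *-nonneg : ∀ {x y} → 0# ≤ x → 0# ≤ y → 0# ≤ x * y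
  *-nonneg {x} 0≤x 0≤y = ≤-respˡ-≈ (zeroʳ x) (*-monoˡ-≤ 0≤x 0≤y)

  x*x⁻¹≈1 : ∀ {x} → 0# < x → x * x ⁻¹ ≈ 1#
  x*x⁻¹≈1 {x} 0<x = ⁻¹-inverse x (λ x≈0 → <-irrefl (<-respʳ-≈ x≈0 0<x))

  ⁻¹-pos : ∀ {x} → 0# < x → 0# < x ⁻¹
  ⁻¹-pos {x} 0<x with compare 0# (x ⁻¹)
  ... | tri< 0<x⁻¹ _ _ = 0<x⁻¹
  ... | tri≈ _ 0≈x⁻¹ _ =
    ⊥-elim (nontrivial (trans (sym (x*x⁻¹≈1 0<x)) (trans (*-congˡ (sym 0≈x⁻¹)) (zeroʳ x))))
  ... | tri> _ _ x⁻¹<0 =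
    ⊥-elim (asym 0<1 (<-respˡ-≈ (x*x⁻¹≈1 0<x) (<-respʳ-≈ (zeroʳ x) (*-monoˡ-< 0<x x⁻¹<0))))

  x*[y/x]≈y : ∀ {x} y → 0# < x → x * (y / x) ≈ y
  x*[y/x]≈y {x} y 0<x = begin
    x * (y * x ⁻¹) ≈⟨ *-congˡ (*-comm y (x ⁻¹)) ⟩
    x * (x ⁻¹ * y) ≈⟨ *-assoc x (x ⁻¹) y ⟨
    x * x ⁻¹ * y   ≈⟨ *-congʳ (x*x⁻¹≈1 0<x) ⟩
    1# * y         ≈⟨ *-identityˡ y ⟩
    y              ∎
    where open ≈-Reasoning

  [x*y]/y≈x : ∀ {y} x → 0# < y → x * y / y ≈ x
  [x*y]/y≈x {y} x 0<y = trans (*-assoc x y (y ⁻¹)) (trans (*-congˡ (x*x⁻¹≈1 0<y)) (*-identityʳ x))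

  /-monoˡ-< : ∀ {x y d} → 0# < d → x < y → x / d < y / d
  /-monoˡ-< 0<d = *-monoʳ-< (⁻¹-pos 0<d)

  /-monoˡ-≤ : ∀ {x y d} → 0# < d → x ≤ y → x / d ≤ y / d
  /-monoˡ-≤ 0<d = *-monoʳ-≤ (inj₁ (⁻¹-pos 0<d))

  ∃-small : ∀ {c d M} → 0# < c → 0# < d → 0# < M → ∃ λ ε → 0# < ε × ε < c × ε * M < d
  ∃-small {c} {d} {M} 0<c 0<d 0<M =
    c * d / D , *-pos (*-pos 0<c 0<d) (⁻¹-pos 0<D) , ε<c , εM<d
    where
    D : Carrier
    D = d + c * M
    d<D : d < D
    d<D = x<x+y (*-pos 0<c 0<M)
    0<D : 0# < D
    0<D = <-trans 0<d d<D
    ε<c : c * d / D < c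
    ε<c = <-respʳ-≈ ([x*y]/y≈x c 0<D) (/-monoˡ-< 0<D (*-monoˡ-< 0<c d<D))
    cM<D : c * M < D
    cM<D = <-respˡ-≈ (+-identityˡ (c * M)) (+-monoˡ-< (c * M) 0<d)
    εM≈dcM/D : c * d / D * M ≈ d * (c * M) / D
    εM≈dcM/D = begin
      c * d * D ⁻¹ * M   ≈⟨ *-assoc (c * d) (D ⁻¹) M ⟩
      c * d * (D ⁻¹ * M) ≈⟨ *-congˡ (*-comm (D ⁻¹) M) ⟩
      c * d * (M * D ⁻¹) ≈⟨ *-assoc (c * d) M (D ⁻¹) ⟨
      c * d * M * D ⁻¹   ≈⟨ *-congʳ (trans (*-congʳ (*-comm c d)) (*-assoc d c M)) ⟩
      d * (c * M) * D ⁻¹ ∎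
      where open ≈-Reasoning
    εM<d : c * d / D * M < d
    εM<d = <-≈-cong (sym εM≈dcM/D) ([x*y]/y≈x d 0<D) (/-monoˡ-< 0<D (*-monoˡ-< 0<d cM<D))

  x−[x−y]≈y : ∀ x y → x − (x − y) ≈ y
  x−[x−y]≈y x y = begin
    x + - (x − y) ≈⟨ +-congˡ (⁻¹-anti-homo‿- x y) ⟩
    x + (y − x)   ≈⟨ x∙yz≈y∙xz x y (- x) ⟩
    y + (x − x)   ≈⟨ +-congˡ (-‿inverseʳ x) ⟩
    y + 0#        ≈⟨ +-identityʳ y ⟩
    y             ∎
    where open ≈-Reasoning

  −-cancelʳ-< : ∀ {x y z} → x − z < y − z → x < y
  −-cancelʳ-< {x} {y} {z} x−z<y−z =
    <-≈-cong (//-rightDividesˡ z x) (//-rightDividesˡ z y) (+-monoˡ-< z x−z<y−z)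

  −-cancelˡ-< : ∀ {x y z} → z − x < z − y → y < x
  −-cancelˡ-< {x} {y} {z} z−x<z−y =
    −-cancelʳ-< (<-≈-cong (⁻¹-anti-homo‿- z y) (⁻¹-anti-homo‿- z x) (-‿anti-< z−x<z−y))

  -- The embedding of ℕ

  fromℕ-+ : ∀ a b → fromℕ (a ℕ.+ b) ≈ fromℕ a + fromℕ b
  fromℕ-+ zero    b = sym (+-identityˡ (fromℕ b))
  fromℕ-+ (suc a) b = trans (+-congˡ (fromℕ-+ a b)) (sym (+-assoc 1# (fromℕ a) (fromℕ b)))

  fromℕ-* : ∀ a b → fromℕ (a ℕ.* b) ≈ fromℕ a * fromℕ b
  fromℕ-* zero    b = sym (zeroˡ (fromℕ b))
  fromℕ-* (suc a) b = begin
    fromℕ (b ℕ.+ a ℕ.* b)           ≈⟨ fromℕ-+ b (a ℕ.* b) ⟩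
    fromℕ b + fromℕ (a ℕ.* b)       ≈⟨ +-cong (sym (*-identityˡ (fromℕ b))) (fromℕ-* a b) ⟩
    1# * fromℕ b + fromℕ a * fromℕ b ≈⟨ distribʳ (fromℕ b) 1# (fromℕ a) ⟨
    (1# + fromℕ a) * fromℕ b        ∎
    where open ≈-Reasoning

  fromℕ-nonneg : ∀ k → 0# ≤ fromℕ k
  fromℕ-nonneg zero    = ≤-refl
  fromℕ-nonneg (suc k) = ≤-trans (inj₁ 0<1) (x≤x+y (fromℕ-nonneg k))

  fromℕ-pos : ∀ k → 0# < fromℕ (suc k)
  fromℕ-pos k = <-≤-trans 0<1 (x≤x+y (fromℕ-nonneg k))

  fromℕ-mono : ∀ {a b} → a ℕ.≤ b → fromℕ a ≤ fromℕ b
  fromℕ-mono {a} {b} a≤b = ≤-respʳ-≈ a+[b∸a]≈b (x≤x+y (fromℕ-nonneg (b ℕ.∸ a)))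
    where
    a+[b∸a]≈b : fromℕ a + fromℕ (b ℕ.∸ a) ≈ fromℕ b
    a+[b∸a]≈b = trans (sym (fromℕ-+ a (b ℕ.∸ a))) (reflexive (≡.cong fromℕ (ℕ.m+[n∸m]≡n a≤b)))

  fromℕ-sumℕ : ∀ {k} (v : Fin k → ℕ) → fromℕ (sumℕ v) ≈ Σ[ (λ i → fromℕ (v i)) ]
  fromℕ-sumℕ {zero}  v = refl
  fromℕ-sumℕ {suc k} v = trans (fromℕ-+ (v Fin.zero) _) (+-congˡ (fromℕ-sumℕ (λ i → v (Fin.suc i))))

  -- Finite sums

  Σ-cong : ∀ {k} {v w : Fin k → Carrier} → (∀ i → v i ≈ w i) → Σ[ v ] ≈ Σ[ w ]
  Σ-cong {zero}  v≈w = refl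
  Σ-cong {suc k} v≈w = +-cong (v≈w Fin.zero) (Σ-cong (λ i → v≈w (Fin.suc i)))

  Σ-mono-≤ : ∀ {k} {v w : Fin k → Carrier} → (∀ i → v i ≤ w i) → Σ[ v ] ≤ Σ[ w ]
  Σ-mono-≤ {zero}  v≤w = ≤-refl
  Σ-mono-≤ {suc k} v≤w = +-mono-≤ (v≤w Fin.zero) (Σ-mono-≤ (λ i → v≤w (Fin.suc i)))

  Σ-zero : ∀ {k} → Σ[ (λ (_ : Fin k) → 0#) ] ≈ 0#
  Σ-zero {zero}  = refl
  Σ-zero {suc k} = trans (+-identityˡ _) (Σ-zero {k})

  Σ-nonneg : ∀ {k} {v : Fin k → Carrier} → (∀ i → 0# ≤ v i) → 0# ≤ Σ[ v ]
  Σ-nonneg {k} 0≤v = ≤-respˡ-≈ (Σ-zero {k}) (Σ-mono-≤ 0≤v)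

  Σ-distrib-+ : ∀ {k} (v w : Fin k → Carrier) → Σ[ (λ i → v i + w i) ] ≈ Σ[ v ] + Σ[ w ]
  Σ-distrib-+ {zero}  v w = sym (+-identityˡ 0#)
  Σ-distrib-+ {suc k} v w =
    trans (+-congˡ (Σ-distrib-+ (λ i → v (Fin.suc i)) (λ i → w (Fin.suc i))))
          (interchange (v Fin.zero) (w Fin.zero) _ _)

  Σ-neg : ∀ {k} (v : Fin k → Carrier) → Σ[ (λ i → - v i) ] ≈ - Σ[ v ]
  Σ-neg {zero}  v = sym -0#≈0#
  Σ-neg {suc k} v = trans (+-congˡ (Σ-neg (λ i → v (Fin.suc i)))) (⁻¹-∙-comm _ _)

  Σ-distribˡ-* : ∀ {k} c (v : Fin k → Carrier) → Σ[ (λ i → c * v i) ] ≈ c * Σ[ v ]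
  Σ-distribˡ-* {zero}  c v = sym (zeroʳ c)
  Σ-distribˡ-* {suc k} c v =
    trans (+-congˡ (Σ-distribˡ-* c (λ i → v (Fin.suc i)))) (sym (distribˡ c _ _))

  Σ-const : ∀ {k} c → Σ[ (λ (_ : Fin k) → c) ] ≈ fromℕ k * c
  Σ-const {zero}  c = sym (zeroˡ c)
  Σ-const {suc k} c =
    trans (+-cong (sym (*-identityˡ c)) (Σ-const {k} c)) (sym (distribʳ c 1# (fromℕ k)))

  Σ-comm : ∀ {a b} (v : Fin a → Fin b → Carrier) →
           Σ[ (λ i → Σ[ v i ]) ] ≈ Σ[ (λ j → Σ[ (λ i → v i j) ]) ]
  Σ-comm {zero}  {b} v = sym (Σ-zero {b})
  Σ-comm {suc a}     v = trans (+-congˡ (Σ-comm (λ i → v (Fin.suc i))))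
                               (sym (Σ-distrib-+ (v Fin.zero) _))

  Σ≉0⇒∃≉0 : ∀ {k} (v : Fin k → Carrier) → ¬ (Σ[ v ] ≈ 0#) → ∃ λ i → ¬ (v i ≈ 0#)
  Σ≉0⇒∃≉0 {zero}  v Σ≉0 = ⊥-elim (Σ≉0 refl)
  Σ≉0⇒∃≉0 {suc k} v Σ≉0 with v Fin.zero ≟ 0#
  ... | no v₀≉0 = Fin.zero , v₀≉0
  ... | yes v₀≈0 =
    let i , vᵢ≉0 = Σ≉0⇒∃≉0 (λ i → v (Fin.suc i))
                     (λ Σ≈0 → Σ≉0 (trans (+-cong v₀≈0 Σ≈0) (+-identityˡ 0#)))
    in Fin.suc i , vᵢ≉0

  Π-pos : ∀ {k} (v : Fin k → Carrier) → (∀ i → 0# < v i) → 0# < Π[ v ]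
  Π-pos {zero}  v 0<v = 0<1
  Π-pos {suc k} v 0<v = *-pos (0<v Fin.zero) (Π-pos (λ i → v (Fin.suc i)) (λ i → 0<v (Fin.suc i)))

  δ : ∀ {k} → Fin k → Fin k → Carrier
  δ Fin.zero    Fin.zero    = 1#
  δ Fin.zero    (Fin.suc _) = 0#
  δ (Fin.suc _) Fin.zero    = 0#
  δ (Fin.suc i) (Fin.suc j) = δ i j

  δ≉0⇒≡ : ∀ {k} (i j : Fin k) → ¬ (δ i j ≈ 0#) → i ≡ j
  δ≉0⇒≡ Fin.zero    Fin.zero    _   = ≡.refl
  δ≉0⇒≡ Fin.zero    (Fin.suc _) δ≉0 = ⊥-elim (δ≉0 refl)
  δ≉0⇒≡ (Fin.suc _) Fin.zero    δ≉0 = ⊥-elim (δ≉0 refl)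
  δ≉0⇒≡ (Fin.suc i) (Fin.suc j) δ≉0 = ≡.cong Fin.suc (δ≉0⇒≡ i j δ≉0)

  Σ-zeroˡ : ∀ {k} (w : Fin k → Carrier) → Σ[ (λ i → 0# * w i) ] ≈ 0#
  Σ-zeroˡ {k} w = trans (Σ-cong (λ i → zeroˡ (w i))) (Σ-zero {k})

  Σ-δʳ : ∀ {k} (i : Fin k) (w : Fin k → Carrier) → Σ[ (λ j → δ i j * w j) ] ≈ w i
  Σ-δʳ {suc k} Fin.zero    w = trans (+-cong (*-identityˡ _) (Σ-zeroˡ (λ j → w (Fin.suc j)))) (+-identityʳ _)
  Σ-δʳ {suc k} (Fin.suc i) w = trans (+-cong (zeroˡ _) (Σ-δʳ i (λ j → w (Fin.suc j)))) (+-identityˡ _)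

  Σ-δˡ : ∀ {k} (j : Fin k) (w : Fin k → Carrier) → Σ[ (λ i → δ i j * w i) ] ≈ w j
  Σ-δˡ {suc k} Fin.zero    w = trans (+-cong (*-identityˡ _) (Σ-zeroˡ (λ i → w (Fin.suc i)))) (+-identityʳ _)
  Σ-δˡ {suc k} (Fin.suc j) w = trans (+-cong (zeroˡ _) (Σ-δˡ j (λ i → w (Fin.suc i)))) (+-identityˡ _)

  -- Maxima, absolute values and norms

  x≤max[x,y] : ∀ x y → x ≤ max x y
  x≤max[x,y] x y with compare x y
  ... | tri< x<y _ _ = inj₁ x<y
  ... | tri≈ _ _ _   = ≤-refl
  ... | tri> _ _ _   = ≤-refl

  y≤max[x,y] : ∀ x y → y ≤ max x y
  y≤max[x,y] x y with compare x y
  ... | tri< _ _ _   = ≤-refl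
  ... | tri≈ _ x≈y _ = inj₂ (sym x≈y)
  ... | tri> _ _ y<x = inj₁ y<x

  max-lub : ∀ {x y b} → x ≤ b → y ≤ b → max x y ≤ b
  max-lub {x} {y} x≤b y≤b with compare x y
  ... | tri< _ _ _ = y≤b
  ... | tri≈ _ _ _ = x≤b
  ... | tri> _ _ _ = x≤b

  Max-ub : ∀ {k} (v : Fin k → Carrier) i → v i ≤ Max[ v ]
  Max-ub v Fin.zero    = x≤max[x,y] _ _
  Max-ub v (Fin.suc i) = ≤-trans (Max-ub (λ j → v (Fin.suc j)) i) (y≤max[x,y] _ _)

  Max-lub : ∀ {k} {v : Fin k → Carrier} {b} → 0# ≤ b → (∀ i → v i ≤ b) → Max[ v ] ≤ b
  Max-lub {zero}  0≤b v≤b = 0≤b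
  Max-lub {suc k} 0≤b v≤b = max-lub (v≤b Fin.zero) (Max-lub 0≤b (λ i → v≤b (Fin.suc i)))

  Max-nonneg : ∀ {k} (v : Fin k → Carrier) → 0# ≤ Max[ v ]
  Max-nonneg {zero}  v = ≤-refl
  Max-nonneg {suc k} v = ≤-trans (Max-nonneg (λ i → v (Fin.suc i))) (y≤max[x,y] _ _)

  0≤x⇒∣x∣≈x : ∀ {x} → 0# ≤ x → ∣ x ∣ ≈ x
  0≤x⇒∣x∣≈x {x} 0≤x with compare x 0#
  ... | tri< x<0 _ _ = ⊥-elim (≤⇒≯ 0≤x x<0)
  ... | tri≈ _ _ _   = refl
  ... | tri> _ _ _   = refl

  ∣x∣-nonneg : ∀ x → 0# ≤ ∣ x ∣
  ∣x∣-nonneg x with compare x 0#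
  ... | tri< x<0 _ _ = inj₁ (x<0⇒0<-x x<0)
  ... | tri≈ _ x≈0 _ = inj₂ (sym x≈0)
  ... | tri> _ _ 0<x = inj₁ 0<x

  x≤∣x∣ : ∀ x → x ≤ ∣ x ∣
  x≤∣x∣ x with compare x 0#
  ... | tri< x<0 _ _ = inj₁ (<-trans x<0 (x<0⇒0<-x x<0))
  ... | tri≈ _ _ _   = ≤-refl
  ... | tri> _ _ _   = ≤-refl

  x≤‖x‖∞ : ∀ {k} (v : Fin k → Carrier) i → v i ≤ ‖ v ‖∞
  x≤‖x‖∞ v i = ≤-trans (x≤∣x∣ (v i)) (Max-ub (λ j → ∣ v j ∣) i)

  ‖‖∞-nonneg : ∀ {k} (v : Fin k → Carrier) → 0# ≤ ‖ v ‖∞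
  ‖‖∞-nonneg v = Max-nonneg (λ j → ∣ v j ∣)

  ‖‖₁-nonneg : ∀ {k} (v : Fin k → Carrier) → 0# ≤ ‖ v ‖₁
  ‖‖₁-nonneg v = Σ-nonneg (λ j → ∣x∣-nonneg (v j))

  ‖‖₁≤k*‖‖∞ : ∀ {k} (v : Fin k → Carrier) → ‖ v ‖₁ ≤ fromℕ k * ‖ v ‖∞
  ‖‖₁≤k*‖‖∞ {k} v = ≤-respʳ-≈ (Σ-const {k} ‖ v ‖∞) (Σ-mono-≤ (Max-ub (λ j → ∣ v j ∣)))

  -- Powers

  ^-congˡ : ∀ {x y} k → x ≈ y → x ^ k ≈ y ^ k
  ^-congˡ zero    x≈y = refl
  ^-congˡ (suc k) x≈y = *-cong x≈y (^-congˡ k x≈y)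

  ^-nonneg : ∀ {x} k → 0# ≤ x → 0# ≤ x ^ k
  ^-nonneg zero    0≤x = inj₁ 0<1
  ^-nonneg (suc k) 0≤x = *-nonneg 0≤x (^-nonneg k 0≤x)

  ^-pos : ∀ {x} k → 0# < x → 0# < x ^ k
  ^-pos zero    0<x = 0<1
  ^-pos (suc k) 0<x = *-pos 0<x (^-pos k 0<x)

  ^-mono-≤ : ∀ {a b} k → 0# ≤ a → a ≤ b → a ^ k ≤ b ^ k
  ^-mono-≤ zero    0≤a a≤b = ≤-refl
  ^-mono-≤ (suc k) 0≤a a≤b = *-mono-≤ 0≤a (^-nonneg k 0≤a) a≤b (^-mono-≤ k 0≤a a≤b)

  1^k≈1 : ∀ k → 1# ^ k ≈ 1#
  1^k≈1 zero    = refl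
  1^k≈1 (suc k) = trans (*-identityˡ _) (1^k≈1 k)

  x≤x^[1+k] : ∀ {x} k → 1# ≤ x → x ≤ x ^ suc k
  x≤x^[1+k] {x} k 1≤x = ≤-respˡ-≈ (*-identityʳ x)
    (*-monoˡ-≤ (≤-trans (inj₁ 0<1) 1≤x) (≤-respˡ-≈ (1^k≈1 k) (^-mono-≤ k (inj₁ 0<1) 1≤x)))

  ^-−-≤ : ∀ {a b} k → 0# ≤ a → a ≤ b →
          b ^ suc k − a ^ suc k ≤ (b − a) * (fromℕ (suc k) * b ^ k)
  ^-−-≤ {a} {b} zero _ _ = inj₂ (begin
    b * 1# − a * 1#          ≈⟨ +-cong (*-identityʳ b) (-‿cong (*-identityʳ a)) ⟩
    b − a                    ≈⟨ *-identityʳ (b − a) ⟨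
    (b − a) * 1#             ≈⟨ *-congˡ (trans (*-identityʳ _) (+-identityʳ 1#)) ⟨
    (b − a) * ((1# + 0#) * 1#) ∎)
    where open ≈-Reasoning
  ^-−-≤ {a} {b} (suc k) 0≤a a≤b = begin
    b * B − a * A                   ≈⟨ split ⟩
    b * (B − A) + (b − a) * A       ≤⟨ +-mono-≤ (*-monoˡ-≤ 0≤b (^-−-≤ k 0≤a a≤b))
                                                (*-monoˡ-≤ (≤⇒0≤− a≤b) (^-mono-≤ (suc k) 0≤a a≤b)) ⟩
    b * (d * (N * b ^ k)) + d * B   ≈⟨ collect ⟩
    d * ((1# + N) * B)              ∎
    where
    open ≤-Reasoning
    0≤b : 0# ≤ b
    0≤b = ≤-trans 0≤a a≤b
    d N A B : Carrier
    d = b − a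
    N = fromℕ (suc k)
    A = a ^ suc k
    B = b ^ suc k
    split : b * B − a * A ≈ b * (B − A) + (b − a) * A
    split = sym (trans (+-cong (x[y-z]≈xy-xz b B A) ([y-z]x≈yx-zx A b a))
                       ([x−y]+[y−z]≈x−z (b * B) (b * A) (a * A)))
    collect : b * (d * (N * b ^ k)) + d * B ≈ d * ((1# + N) * B)
    collect = begin-equality
      b * (d * (N * b ^ k)) + d * B ≈⟨ +-congʳ (trans (x*yz≈y*xz b d _) (*-congˡ (x*yz≈y*xz b N _))) ⟩
      d * (N * B) + d * B           ≈⟨ distribˡ d (N * B) B ⟨
      d * (N * B + B)               ≈⟨ *-congˡ (trans (+-congʳ (*-identityˡ B)) (+-comm B _)) ⟨
      d * (1# * B + N * B)          ≈⟨ *-congˡ (distribʳ B 1# N) ⟨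
      d * ((1# + N) * B)            ∎

module CompletenessProperties (R : CompleteOrderedField) where
  open CompleteOrderedField R
  open OrderedFieldProperties R
  open import Algebra.Properties.AbelianGroup +-abelianGroup using (xyx⁻¹≈y)
  open import Algebra.Properties.Ring ring using (-0#≈0#)

  -- Comparing the supremum of {0} ∪ {1 | Q} with 0 decides ¬ Q.
  ¬-dec : (Q : Set) → Dec (¬ Q)
  ¬-dec Q with sup S (0# , inj₁ refl) (1# , S≤1)
    where
    S : Carrier → Set
    S x = x ≈ 0# ⊎ (x ≈ 1# × Q)
    S≤1 : ∀ x → S x → x ≤ 1#
    S≤1 x (inj₁ x≈0)       = inj₁ (<-respˡ-≈ (sym x≈0) 0<1)
    S≤1 x (inj₂ (x≈1 , _)) = inj₂ x≈1
  ... | s , s-ub , s-least with compare s 0#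
  ...   | tri< s<0 _ _ = ⊥-elim (≤⇒≯ (s-ub 0# (inj₁ refl)) s<0)
  ...   | tri≈ _ s≈0 _ = yes λ q → ≤⇒≯ (s-ub 1# (inj₂ (refl , q))) (<-respˡ-≈ (sym s≈0) 0<1)
  ...   | tri> _ _ 0<s = no λ ¬q → ≤⇒≯ (s-least 0# λ { x (inj₁ x≈0) → inj₂ x≈0
                                                      ; x (inj₂ (_ , q)) → ⊥-elim (¬q q) }) 0<s

  module _ (k : ℕ) {P : Carrier} (0<P : 0# < P) where

    Below : Carrier → Set
    Below x = 0# ≤ x × x ^ suc k ≤ P

    0∈Below : Below 0#
    0∈Below = ≤-refl , inj₁ (<-respˡ-≈ (sym (zeroˡ _)) 0<P)

    Below≤1+P : ∀ x → Below x → x ≤ 1# + P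
    Below≤1+P x (_ , x^N≤P) = ≮⇒≥ λ 1+P<x →
      ≤⇒≯ x^N≤P (<-≤-trans (<-trans P<1+P 1+P<x) (x≤x^[1+k] k (≤-trans 1≤1+P (inj₁ 1+P<x))))
      where
      P<1+P : P < 1# + P
      P<1+P = <-respˡ-≈ (+-identityˡ P) (+-monoˡ-< P 0<1)
      1≤1+P : 1# ≤ 1# + P
      1≤1+P = x≤x+y (inj₁ 0<P)

    module _ {s} (s-ub : ∀ x → Below x → x ≤ s)
                 (s-least : ∀ b → (∀ x → Below x → x ≤ b) → s ≤ b) where

      0≤s : 0# ≤ s
      0≤s = s-ub 0# 0∈Below

      0<s+1 : 0# < s + 1#
      0<s+1 = ≤-<-trans 0≤s (x<x+y 0<1)

      -- Otherwise s + ε ∈ Below for a small ε > 0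
      s^[1+k]≮P : ¬ (s ^ suc k < P)
      s^[1+k]≮P s^N<P with ∃-small 0<1 (<⇒0<− s^N<P) (*-pos (fromℕ-pos k) (^-pos k 0<s+1))
      ... | ε , 0<ε , ε<1 , εM<P−s^N = ≤⇒≯ (s-ub (s + ε) (0≤s+ε , inj₁ [s+ε]^N<P)) s<s+ε
        where
        s<s+ε : s < s + ε
        s<s+ε = x<x+y 0<ε
        0≤s+ε : 0# ≤ s + ε
        0≤s+ε = ≤-trans 0≤s (inj₁ s<s+ε)
        [s+ε]^N<P : (s + ε) ^ suc k < P
        [s+ε]^N<P = −-cancelʳ-< (begin-strict
          (s + ε) ^ suc k − s ^ suc k                   ≤⟨ ^-−-≤ k 0≤s (inj₁ s<s+ε) ⟩
          (s + ε − s) * (fromℕ (suc k) * (s + ε) ^ k)   ≈⟨ *-congʳ (xyx⁻¹≈y s ε) ⟩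
          ε * (fromℕ (suc k) * (s + ε) ^ k)             ≤⟨ *-monoˡ-≤ (inj₁ 0<ε)
                                                             (*-monoˡ-≤ (fromℕ-nonneg (suc k))
                                                               (^-mono-≤ k 0≤s+ε (+-monoʳ-≤ s (inj₁ ε<1)))) ⟩
          ε * (fromℕ (suc k) * (s + 1#) ^ k)            <⟨ εM<P−s^N ⟩
          P − s ^ suc k                                 ∎)
          where open ≤-Reasoning

      0<s : 0# < s
      0<s with 0≤s
      ... | inj₁ 0<s = 0<s
      ... | inj₂ 0≈s = ⊥-elim (s^[1+k]≮P (<-respˡ-≈ 0≈s^N 0<P))
        where
        0≈s^N : 0# ≈ s ^ suc k
        0≈s^N = trans (sym (zeroˡ _)) (^-congˡ (suc k) 0≈s)

      -- Otherwise s − ε is an upper bound of Below for a small ε > 0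
      P≮s^[1+k] : ¬ (P < s ^ suc k)
      P≮s^[1+k] P<s^N with ∃-small 0<s (<⇒0<− P<s^N) (*-pos (fromℕ-pos k) (^-pos k 0<s))
      ... | ε , 0<ε , ε<s , εM<s^N−P = ≤⇒≯ (s-least (s − ε) s−ε-ub) s−ε<s
        where
        0≤s−ε : 0# ≤ s − ε
        0≤s−ε = inj₁ (<⇒0<− ε<s)
        s−ε<s : s − ε < s
        s−ε<s = <-respʳ-≈ (+-identityʳ s) (+-monoʳ-< s (<-respʳ-≈ -0#≈0# (-‿anti-< 0<ε)))
        P<[s−ε]^N : P < (s − ε) ^ suc k
        P<[s−ε]^N = −-cancelˡ-< (begin-strict
          s ^ suc k − (s − ε) ^ suc k                   ≤⟨ ^-−-≤ k 0≤s−ε (inj₁ s−ε<s) ⟩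
          (s − (s − ε)) * (fromℕ (suc k) * s ^ k)       ≈⟨ *-congʳ (x−[x−y]≈y s ε) ⟩
          ε * (fromℕ (suc k) * s ^ k)                   <⟨ εM<s^N−P ⟩
          s ^ suc k − P                                 ∎)
          where open ≤-Reasoning
        s−ε-ub : ∀ x → Below x → x ≤ s − ε
        s−ε-ub x (_ , x^N≤P) = ≮⇒≥ λ s−ε<x →
          ≤⇒≯ x^N≤P (<-≤-trans P<[s−ε]^N (^-mono-≤ (suc k) 0≤s−ε (inj₁ s−ε<x)))

    ∃-root : ∃ λ g → 0# < g × g ^ suc k ≈ P
    ∃-root with sup Below (0# , 0∈Below) (1# + P , Below≤1+P)
    ... | s , s-ub , s-least with compare (s ^ suc k) P
    ...   | tri< s^N<P _ _ = ⊥-elim (s^[1+k]≮P s-ub s-least s^N<P)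
    ...   | tri≈ _ s^N≈P _ = s , 0<s s-ub s-least , s^N≈P
    ...   | tri> _ _ P<s^N = ⊥-elim (P≮s^[1+k] s-ub s-least P<s^N)

module Flows (R : CompleteOrderedField) {n : ℕ} (u : Fin n → Fin n → CompleteOrderedField.Carrier R) where
  open CompleteOrderedField R
  open OrderedFieldProperties R
  open Market R u
  open import Algebra.Properties.Ring ring using (-‿involutive; -‿distribʳ-*)
  open import Relation.Binary.Construct.Closure.ReflexiveTransitive using (ε)

  ∂ : Flow → Vertex → Carrier
  ∂ h (inj₁ i) = Σ[ (λ j → h i j) ]
  ∂ h (inj₂ j) = Σ[ (λ i → h i j) ]

  ∂-+ : ∀ h h′ v → ∂ (λ i j → h i j + h′ i j) v ≈ ∂ h v + ∂ h′ v
  ∂-+ h h′ (inj₁ i) = Σ-distrib-+ (λ j → h i j) (λ j → h′ i j)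
  ∂-+ h h′ (inj₂ j) = Σ-distrib-+ (λ i → h i j) (λ i → h′ i j)

  ∂-zero : ∀ v → ∂ (λ _ _ → 0#) v ≈ 0#
  ∂-zero (inj₁ _) = Σ-zero {n}
  ∂-zero (inj₂ _) = Σ-zero {n}

  ∂-Σ² : ∀ (H : Fin n → Fin n → Flow) v →
         ∂ (λ i j → Σ[ (λ k → Σ[ (λ l → H k l i j) ]) ]) v ≈ Σ[ (λ k → Σ[ (λ l → ∂ (H k l) v) ]) ]
  ∂-Σ² H (inj₁ i) = trans (Σ-comm (λ j k → Σ[ (λ l → H k l i j) ]))
                          (Σ-cong (λ k → Σ-comm (λ j l → H k l i j)))
  ∂-Σ² H (inj₂ j) = trans (Σ-comm (λ i k → Σ[ (λ l → H k l i j) ]))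
                          (Σ-cong (λ k → Σ-comm (λ i l → H k l i j)))

  δᵥ : Vertex → Vertex → Carrier
  δᵥ (inj₁ k) (inj₁ i) = δ k i
  δᵥ (inj₂ k) (inj₂ j) = δ k j
  δᵥ (inj₁ _) (inj₂ _) = 0#
  δᵥ (inj₂ _) (inj₁ _) = 0#

  edgeFlow : Fin n → Fin n → Carrier → Flow
  edgeFlow i j a i′ j′ = δ i i′ * (δ j j′ * a)

  ∂-edgeFlow : ∀ i j a v → ∂ (edgeFlow i j a) v ≈ δᵥ (inj₁ i) v * a + δᵥ (inj₂ j) v * a
  ∂-edgeFlow i j a (inj₁ i′) = begin
    Σ[ (λ j′ → δ i i′ * (δ j j′ * a)) ] ≈⟨ Σ-distribˡ-* (δ i i′) (λ j′ → δ j j′ * a) ⟩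
    δ i i′ * Σ[ (λ j′ → δ j j′ * a) ]   ≈⟨ *-congˡ (Σ-δʳ j (λ _ → a)) ⟩
    δ i i′ * a                          ≈⟨ +-identityʳ _ ⟨
    δ i i′ * a + 0#                     ≈⟨ +-congˡ (zeroˡ a) ⟨
    δ i i′ * a + 0# * a                 ∎
    where open ≈-Reasoning
  ∂-edgeFlow i j a (inj₂ j′) =
    trans (Σ-δʳ i (λ _ → δ j j′ * a)) (sym (trans (+-congʳ (zeroˡ a)) (+-identityˡ _)))

  edgeFlow-supp : ∀ i j a i′ j′ → ¬ (edgeFlow i j a i′ j′ ≈ 0#) → i ≡ i′ × j ≡ j′
  edgeFlow-supp i j a i′ j′ flow≉0 =
    δ≉0⇒≡ i i′ (λ δ≈0 → flow≉0 (trans (*-congʳ δ≈0) (zeroˡ _))) ,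
    δ≉0⇒≡ j j′ (λ δ≈0 → flow≉0 (trans (*-congˡ (trans (*-congʳ δ≈0) (zeroˡ a))) (zeroʳ _)))

  module _ {F : EdgeSet} where

    stepFlow : ∀ {x y} → Adj F x y → Carrier → Flow
    stepFlow (ag {i} {j} _) = edgeFlow i j
    stepFlow (ga {i} {j} _) = edgeFlow i j

    ∂-stepFlow : ∀ {x y} (e : Adj F x y) a v → ∂ (stepFlow e a) v ≈ δᵥ x v * a + δᵥ y v * a
    ∂-stepFlow (ag {i} {j} _) a v = ∂-edgeFlow i j a v
    ∂-stepFlow (ga {i} {j} _) a v = trans (∂-edgeFlow i j a v) (+-comm _ _)

    stepFlow-supp : ∀ {x y} (e : Adj F x y) a i j → ¬ (stepFlow e a i j ≈ 0#) → F i j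
    stepFlow-supp (ag {i} {j} Fij) a i′ j′ flow≉0 with edgeFlow-supp i j a i′ j′ flow≉0
    ... | ≡.refl , ≡.refl = Fij
    stepFlow-supp (ga {i} {j} Fij) a i′ j′ flow≉0 with edgeFlow-supp i j a i′ j′ flow≉0
    ... | ≡.refl , ≡.refl = Fij

    sign : Vertex → Carrier → Carrier
    sign (inj₁ _) c = c
    sign (inj₂ _) c = - c

    sign-step : ∀ {x y} → Adj F x y → ∀ c → sign y c ≈ - sign x c
    sign-step (ag _) c = refl
    sign-step (ga _) c = sym (-‿involutive c)

    -- By sign-step, the signs alternate along the path, so the flow cancels at interior vertices.
    pathFlow : ∀ {x y} → Star (Adj F) x y → Carrier → Flow
    pathFlow ε           c = λ _ _ → 0#
    pathFlow {x} (e ◅ π) c = λ i j → stepFlow e (sign x c) i j + pathFlow π c i j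

    ∂-pathFlow : ∀ {x y} (π : Star (Adj F) x y) c v →
                 ∂ (pathFlow π c) v ≈ δᵥ x v * sign x c − δᵥ y v * sign y c
    ∂-pathFlow {x} ε c v = trans (∂-zero v) (sym (-‿inverseʳ (δᵥ x v * sign x c)))
    ∂-pathFlow {x} (_◅_ {j = y} {k = z} e π) c v = begin
      ∂ (pathFlow (e ◅ π) c) v
        ≈⟨ ∂-+ (stepFlow e (sign x c)) (pathFlow π c) v ⟩
      ∂ (stepFlow e (sign x c)) v + ∂ (pathFlow π c) v
        ≈⟨ +-cong (∂-stepFlow e (sign x c) v) (∂-pathFlow π c v) ⟩
      (δᵥ x v * sign x c + δᵥ y v * sign x c) + (δᵥ y v * sign y c − δᵥ z v * sign z c)
        ≈⟨ +-assoc _ _ _ ⟩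
      δᵥ x v * sign x c + (δᵥ y v * sign x c + (δᵥ y v * sign y c − δᵥ z v * sign z c))
        ≈⟨ +-congˡ (+-assoc _ _ _) ⟨
      δᵥ x v * sign x c + ((δᵥ y v * sign x c + δᵥ y v * sign y c) − δᵥ z v * sign z c)
        ≈⟨ +-congˡ (+-congʳ y-terms-cancel) ⟩
      δᵥ x v * sign x c + (0# − δᵥ z v * sign z c)
        ≈⟨ +-congˡ (+-identityˡ _) ⟩
      δᵥ x v * sign x c − δᵥ z v * sign z c ∎
      where
      open ≈-Reasoning
      y-terms-cancel : δᵥ y v * sign x c + δᵥ y v * sign y c ≈ 0#
      y-terms-cancel = begin
        δᵥ y v * sign x c + δᵥ y v * sign y c ≈⟨ distribˡ (δᵥ y v) _ _ ⟨
        δᵥ y v * (sign x c + sign y c)        ≈⟨ *-congˡ (+-congˡ (sign-step e c)) ⟩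
        δᵥ y v * (sign x c − sign x c)        ≈⟨ *-congˡ (-‿inverseʳ (sign x c)) ⟩
        δᵥ y v * 0#                           ≈⟨ zeroʳ (δᵥ y v) ⟩
        0#                                    ∎

    ∂-agentToGoodPathFlow : ∀ {k l} (π : Star (Adj F) (inj₁ k) (inj₂ l)) c v →
                          ∂ (pathFlow π c) v ≈ δᵥ (inj₁ k) v * c + δᵥ (inj₂ l) v * c
    ∂-agentToGoodPathFlow {l = l} π c v =
      trans (∂-pathFlow π c v)
            (+-congˡ (trans (-‿cong (sym (-‿distribʳ-* (δᵥ (inj₂ l) v) c)))
                            (-‿involutive (δᵥ (inj₂ l) v * c))))

    pathFlow-supp : ∀ {x y} (π : Star (Adj F) x y) c i j → ¬ (pathFlow π c i j ≈ 0#) → F i j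
    pathFlow-supp ε c i j flow≉0 = ⊥-elim (flow≉0 refl)
    pathFlow-supp {x} (e ◅ π) c i j flow≉0 with stepFlow e (sign x c) i j ≟ 0#
    ... | no  step≉0 = stepFlow-supp e (sign x c) i j step≉0
    ... | yes step≈0 = pathFlow-supp π c i j λ rest≈0 →
      flow≉0 (trans (+-cong step≈0 rest≈0) (+-identityˡ 0#))

module Rerouting (R : CompleteOrderedField) {n : ℕ} (u : Fin n → Fin n → CompleteOrderedField.Carrier R)
                 (F : Market.EdgeSet R u) (p : Market.Prices R u) (f : Market.Flow R u)
                 (alloc : Market.IsAllocation R u F p f) where
  open CompleteOrderedField R
  open OrderedFieldProperties R
  open Market R u
  open CompletenessProperties R using (¬-dec)
  open Flows R u
  open IsAllocation alloc
  open import Algebra.Properties.Ring ring using (-0#≈0#)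
  open import Algebra.Properties.CommutativeSemigroup *-commutativeSemigroup using (xy∙z≈xz∙y)
  open import Relation.Binary.Construct.Closure.ReflexiveTransitive using (ε)

  -- m counts an indicator that Defs keeps local to m; unification recovers it.
  edgeIndicator : Σ (Fin n → Fin n → ℕ) λ ι → m ≡ sumℕ (λ k → sumℕ (ι k))
  edgeIndicator = _ , ≡.refl

  ι : Fin n → Fin n → ℕ
  ι = proj₁ edgeIndicator

  ι-E : ∀ k l → E k l → ι k l ≡ 1
  ι-E k l Ekl with compare 0# (u k l)
  ... | tri< _ _ _  = ≡.refl
  ... | tri≈ ¬E _ _ = ⊥-elim (¬E Ekl)
  ... | tri> ¬E _ _ = ⊥-elim (¬E Ekl)

  ι-¬E : ∀ k l → ¬ E k l → ι k l ≡ 0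
  ι-¬E k l ¬Ekl with compare 0# (u k l)
  ... | tri< E _ _ = ⊥-elim (¬Ekl E)
  ... | tri≈ _ _ _ = ≡.refl
  ... | tri> _ _ _ = ≡.refl

  Σι≤m : ∀ l → sumℕ (λ k → ι k l) ℕ.≤ m
  Σι≤m l = ℕ.≤-trans (sumℕ-mono-≤ (λ k → v≤sumℕv (ι k) l))
                     (ℕ.≤-reflexive (≡.sym (proj₂ edgeIndicator)))

  B T K : Carrier
  B = ‖ surplus p f ‖₁
  T = ‖ surplus p f ‖∞
  K = fromℕ (n ℕ.* (m ℕ.+ 1))

  0≤B : 0# ≤ B
  0≤B = ‖‖₁-nonneg (surplus p f)

  0≤T : 0# ≤ T
  0≤T = ‖‖∞-nonneg (surplus p f)

  module _ (linked? : ∀ k l → Dec (SameComponent F (inj₁ k) (inj₂ l))) where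

    kept : Flow
    kept k l with linked? k l
    ... | yes _ = f k l
    ... | no  _ = 0#

    detour : Fin n → Fin n → Flow
    detour k l with linked? k l
    ... | yes π = pathFlow π (f k l)
    ... | no  _ = λ _ _ → 0#

    rerouted : Flow
    rerouted i j = Σ[ (λ k → Σ[ (λ l → detour k l i j) ]) ]

    ∂-detour : ∀ k l v → ∂ (detour k l) v ≈ δᵥ (inj₁ k) v * kept k l + δᵥ (inj₂ l) v * kept k l
    ∂-detour k l v with linked? k l
    ... | yes π = ∂-agentToGoodPathFlow π (f k l) v
    ... | no  _ = trans (∂-zero v) (sym (trans (+-cong (zeroʳ _) (zeroʳ _)) (+-identityˡ 0#)))

    agentSum-rerouted : ∀ i → Σ[ (λ j → rerouted i j) ] ≈ Σ[ (λ l → kept i l) ]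
    agentSum-rerouted i = begin
      ∂ rerouted (inj₁ i)                              ≈⟨ ∂-Σ² detour (inj₁ i) ⟩
      Σ[ (λ k → Σ[ (λ l → ∂ (detour k l) (inj₁ i)) ]) ] ≈⟨ Σ-cong (λ k → Σ-cong (λ l → at-agent k l)) ⟩
      Σ[ (λ k → Σ[ (λ l → δ k i * kept k l) ]) ]        ≈⟨ Σ-cong (λ k → Σ-distribˡ-* (δ k i) (kept k)) ⟩
      Σ[ (λ k → δ k i * Σ[ kept k ]) ]                 ≈⟨ Σ-δˡ i (λ k → Σ[ kept k ]) ⟩
      Σ[ kept i ]                                      ∎
      where
      open ≈-Reasoning
      at-agent : ∀ k l → ∂ (detour k l) (inj₁ i) ≈ δ k i * kept k l
      at-agent k l = trans (∂-detour k l (inj₁ i)) (trans (+-congˡ (zeroˡ _)) (+-identityʳ _))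

    goodSum-rerouted : ∀ j → Σ[ (λ i → rerouted i j) ] ≈ Σ[ (λ k → kept k j) ]
    goodSum-rerouted j = begin
      ∂ rerouted (inj₂ j)                              ≈⟨ ∂-Σ² detour (inj₂ j) ⟩
      Σ[ (λ k → Σ[ (λ l → ∂ (detour k l) (inj₂ j)) ]) ] ≈⟨ Σ-cong (λ k → Σ-cong (λ l → at-good k l)) ⟩
      Σ[ (λ k → Σ[ (λ l → δ l j * kept k l) ]) ]        ≈⟨ Σ-cong (λ k → Σ-δˡ j (kept k)) ⟩
      Σ[ (λ k → kept k j) ]                            ∎
      where
      open ≈-Reasoning
      at-good : ∀ k l → ∂ (detour k l) (inj₂ j) ≈ δ l j * kept k l
      at-good k l = trans (∂-detour k l (inj₂ j)) (trans (+-congʳ (zeroˡ _)) (+-identityˡ _))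

    rerouted-supp : supp rerouted ⊆ F
    rerouted-supp i j rerouted≉0 with Σ≉0⇒∃≉0 (λ k → Σ[ (λ l → detour k l i j) ]) rerouted≉0
    ... | k , Σ≉0 with Σ≉0⇒∃≉0 (λ l → detour k l i j) Σ≉0
    ...   | l , detour≉0 with linked? k l
    ...     | yes π = pathFlow-supp π (f k l) i j detour≉0
    ...     | no  _ = ⊥-elim (detour≉0 refl)

    kept≤f : ∀ k l → kept k l ≤ f k l
    kept≤f k l with linked? k l
    ... | yes _        = ≤-refl
    ... | no  unlinked = flow-nonneg k l (λ Fkl → unlinked (ag Fkl ◅ ε))

    Σkept≤p : ∀ j → Σ[ (λ k → kept k j) ] ≤ p j
    Σkept≤p j = ≤-trans (Σ-mono-≤ (λ k → kept≤f k j)) (good-cap j)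

    rerouted-isAllocation : IsAllocation F p rerouted
    rerouted-isAllocation = record
      { prices-pos   = prices-pos
      ; flow-nonneg  = λ i j ¬Fij → inj₂ (sym (decidable-stable (rerouted i j ≟ 0#)
                                                  (λ ≉0 → ¬Fij (rerouted-supp i j ≉0))))
      ; supp⊆MBB     = λ i j ≉0 → F⊆MBB i j (rerouted-supp i j ≉0)
      ; F⊆MBB        = F⊆MBB
      ; agent-budget = λ i → ≤-respˡ-≈ (sym (agentSum-rerouted i))
                               (≤-trans (Σ-mono-≤ (kept≤f i)) (agent-budget i))
      ; good-cap     = λ j → ≤-respˡ-≈ (sym (goodSum-rerouted j)) (Σkept≤p j)
      }

    module _ (light : ∀ k l → E k l → ¬ SameComponent F (inj₁ k) (inj₂ l) → f k l ≤ B) where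

      dropped≤B*ι : ∀ k l → f k l − kept k l ≤ B * fromℕ (ι k l)
      dropped≤B*ι k l with linked? k l
      ... | yes _ = ≤-respˡ-≈ (sym (-‿inverseʳ (f k l))) (*-nonneg 0≤B (fromℕ-nonneg (ι k l)))
      ... | no unlinked with 0# <? u k l
      ...   | yes Ekl = ≤-respˡ-≈ (sym f−0≈f) (≤-respʳ-≈ (sym B*1≈B) (light k l Ekl unlinked))
        where
        f−0≈f : f k l − 0# ≈ f k l
        f−0≈f = trans (+-congˡ -0#≈0#) (+-identityʳ _)
        B*1≈B : B * fromℕ (ι k l) ≈ B
        B*1≈B = trans (*-congˡ (reflexive (≡.cong fromℕ (ι-E k l Ekl))))
                      (trans (*-congˡ (+-identityʳ 1#)) (*-identityʳ B))
      ...   | no ¬Ekl = inj₂ (begin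
        f k l − 0#           ≈⟨ trans (+-congˡ -0#≈0#) (+-identityʳ _) ⟩
        f k l                ≈⟨ decidable-stable (f k l ≟ 0#) (λ f≉0 → ¬Ekl (proj₁ (supp⊆MBB k l f≉0))) ⟩
        0#                   ≈⟨ zeroʳ B ⟨
        B * 0#               ≈⟨ *-congˡ (reflexive (≡.cong fromℕ (ι-¬E k l ¬Ekl))) ⟨
        B * fromℕ (ι k l)    ∎)
        where open ≈-Reasoning

      Σdropped≤B*m : ∀ j → Σ[ (λ k → f k j − kept k j) ] ≤ B * fromℕ m
      Σdropped≤B*m j = begin
        Σ[ (λ k → f k j − kept k j) ]       ≤⟨ Σ-mono-≤ (λ k → dropped≤B*ι k j) ⟩
        Σ[ (λ k → B * fromℕ (ι k j)) ]      ≈⟨ Σ-distribˡ-* B (λ k → fromℕ (ι k j)) ⟩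
        B * Σ[ (λ k → fromℕ (ι k j)) ]      ≈⟨ *-congˡ (fromℕ-sumℕ (λ k → ι k j)) ⟨
        B * fromℕ (sumℕ (λ k → ι k j))      ≤⟨ *-monoˡ-≤ 0≤B (fromℕ-mono (Σι≤m j)) ⟩
        B * fromℕ m                         ∎
        where open ≤-Reasoning

      surplus-rerouted : ∀ j → surplus p rerouted j ≈ surplus p f j + Σ[ (λ k → f k j − kept k j) ]
      surplus-rerouted j = begin
        p j − Σ[ (λ i → rerouted i j) ]                   ≈⟨ +-congˡ (-‿cong (goodSum-rerouted j)) ⟩
        p j − Σ[ (λ k → kept k j) ]                       ≈⟨ [x−y]+[y−z]≈x−z (p j) _ _ ⟨
        surplus p f j + (Σ[ (λ k → f k j) ] − Σ[ (λ k → kept k j) ]) ≈⟨ +-congˡ Σ-dropped ⟨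
        surplus p f j + Σ[ (λ k → f k j − kept k j) ]    ∎
        where
        open ≈-Reasoning
        Σ-dropped : Σ[ (λ k → f k j − kept k j) ] ≈ Σ[ (λ k → f k j) ] − Σ[ (λ k → kept k j) ]
        Σ-dropped = trans (Σ-distrib-+ (λ k → f k j) (λ k → - kept k j)) (+-congˡ (Σ-neg (λ k → kept k j)))

      ‖surplus-rerouted‖∞≤K*T : 1 ℕ.≤ n → ‖ surplus p rerouted ‖∞ ≤ K * T
      ‖surplus-rerouted‖∞≤K*T 1≤n = Max-lub (*-nonneg (fromℕ-nonneg (n ℕ.* (m ℕ.+ 1))) 0≤T) λ j →
        ≤-respˡ-≈ (sym (0≤x⇒∣x∣≈x (≤⇒0≤− (≤-respˡ-≈ (sym (goodSum-rerouted j)) (Σkept≤p j))))) (begin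
          surplus p rerouted j                            ≈⟨ surplus-rerouted j ⟩
          surplus p f j + Σ[ (λ k → f k j − kept k j) ]  ≤⟨ +-mono-≤ (x≤‖x‖∞ (surplus p f) j) (Σdropped≤B*m j) ⟩
          T + B * fromℕ m                                ≤⟨ +-mono-≤ T≤nT (*-monoʳ-≤ (fromℕ-nonneg m) B≤nT) ⟩
          fromℕ n * T + fromℕ n * T * fromℕ m            ≈⟨ nT+nTm≈K*T ⟩
          K * T                                          ∎)
        where
        open ≤-Reasoning
        T≤nT : T ≤ fromℕ n * T
        T≤nT = ≤-respˡ-≈ (*-identityˡ T) (*-monoʳ-≤ 0≤T (≤-respˡ-≈ (+-identityʳ 1#) (fromℕ-mono 1≤n)))
        B≤nT : B ≤ fromℕ n * T
        B≤nT = ‖‖₁≤k*‖‖∞ (surplus p f)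
        nT+nTm≈K*T : fromℕ n * T + fromℕ n * T * fromℕ m ≈ K * T
        nT+nTm≈K*T = begin-equality
          fromℕ n * T + fromℕ n * T * fromℕ m       ≈⟨ +-congʳ (*-identityʳ _) ⟨
          fromℕ n * T * 1# + fromℕ n * T * fromℕ m  ≈⟨ distribˡ (fromℕ n * T) 1# (fromℕ m) ⟨
          fromℕ n * T * fromℕ (suc m)              ≈⟨ xy∙z≈xz∙y (fromℕ n) T (fromℕ (suc m)) ⟩
          fromℕ n * fromℕ (suc m) * T              ≈⟨ *-congʳ (fromℕ-* n (suc m)) ⟨
          fromℕ (n ℕ.* suc m) * T                  ≈⟨ *-congʳ (reflexive (≡.cong (λ k → fromℕ (n ℕ.* k)) (ℕ.+-comm 1 m))) ⟩
          fromℕ (n ℕ.* (m ℕ.+ 1)) * T              ∎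

      c≤K*φ : 1 ℕ.≤ n → ∀ {c g} → IsLowerBoundΨ F c → IsGeoMean p g → c ≤ K * φ p f g
      c≤K*φ 1≤n {c} {g} Ψ≥c g-geoMean@(0<g , _) = begin
        c                            ≤⟨ Ψ≥c p rerouted rerouted-isAllocation rerouted-supp g g-geoMean ⟩
        ‖ surplus p rerouted ‖∞ / g  ≤⟨ /-monoˡ-≤ 0<g (‖surplus-rerouted‖∞≤K*T 1≤n) ⟩
        K * T / g                    ≈⟨ *-assoc K T (g ⁻¹) ⟩
        K * (T / g)                  ∎
        where open ≤-Reasoning

  heavyEdge : 1 ℕ.≤ n → ∀ {c g} → IsLowerBoundΨ F c → IsGeoMean p g → φ p f g < c / K →
              ∃ λ i → ∃ λ j → E i j × ¬ SameComponent F (inj₁ i) (inj₂ j) × B < f i j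
  heavyEdge 1≤n {c} {g} Ψ≥c g-geoMean φ<c/K with any? (λ i → any? (λ j → heavy? i j))
    where
    heavy? : ∀ i j → Dec (E i j × ¬ SameComponent F (inj₁ i) (inj₂ j) × B < f i j)
    heavy? i j = (0# <? u i j) ×-dec ¬-dec _ ×-dec (B <? f i j)
  ... | yes heavy = heavy
  ... | no  ¬heavy = ⊥-elim (¬¬-linked? λ linked? → <-irrefl (begin-strict
    c            ≤⟨ c≤K*φ linked? light 1≤n Ψ≥c g-geoMean ⟩
    K * φ p f g  <⟨ *-monoˡ-< 0<K φ<c/K ⟩
    K * (c / K)  ≈⟨ x*[y/x]≈y c 0<K ⟩
    c            ∎))
    where
    open ≤-Reasoning
    0<K : 0# < K
    0<K = <-≤-trans 0<1 (≤-respˡ-≈ (+-identityʳ 1#) (fromℕ-mono (ℕ.*-mono-≤ 1≤n (ℕ.m≤n+m 1 m))))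
    light : ∀ k l → E k l → ¬ SameComponent F (inj₁ k) (inj₂ l) → f k l ≤ B
    light k l Ekl unlinked = ≮⇒≥ λ B<fkl → ¬heavy (k , l , Ekl , unlinked , B<fkl)
    -- Connectivity is decidable only under ¬ ¬, which suffices as the goal is ⊥.
    ¬¬-linked? : ¬ ¬ (∀ k l → Dec (SameComponent F (inj₁ k) (inj₂ l)))
    ¬¬-linked? = sequence ¬¬-applicative λ k → sequence ¬¬-applicative λ l → ¬¬-excluded-middle
      where ¬¬-applicative = RawMonad.rawApplicative ¬¬-Monad

lemma3p8 : (R : CompleteOrderedField) (n : ℕ) → 1 ℕ.≤ n →
    (u : Fin n → Fin n → CompleteOrderedField.Carrier R) →
    let open CompleteOrderedField R
        open Market R u
    in (∀ i j → 0# ≤ u i j) →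
       (F : EdgeSet) → F ⊆ E →
       (p : Prices) (f : Flow) → IsAllocation F p f →
       -- φ(p,f) < Ψ(F) / (n (m+1))
       (∃ λ c → IsLowerBoundΨ F c ×
          (∀ g → IsGeoMean p g → φ p f g < c / fromℕ (n ℕ.* (m ℕ.+ 1)))) →
       ∃ λ i → ∃ λ j → E i j × ¬ F i j ×
         ¬ SameComponent F (inj₁ i) (inj₂ j) ×
         ‖ surplus p f ‖₁ < f i j
lemma3p8 R (suc k) 1≤n u _ F _ p f alloc (c , Ψ≥c , φ<c/K) =
  let g , g-geoMean = ∃-root k (Π-pos p prices-pos)
      i , j , Eij , unlinked , B<fij = heavyEdge 1≤n Ψ≥c g-geoMean (φ<c/K g g-geoMean)
  in  i , j , Eij , (λ Fij → unlinked (ag Fij ◅ ε)) , unlinked , B<fij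
  where
  open OrderedFieldProperties R using (Π-pos)
  open CompletenessProperties R using (∃-root)
  open Market R u using (ag; module IsAllocation)
  open IsAllocation alloc using (prices-pos)
  open Rerouting R u F p f alloc using (heavyEdge)
  open import Relation.Binary.Construct.Closure.ReflexiveTransitive using (ε)
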